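{- For every integer $n>1$, there are exactly $2^{\aleph_0}$ pairwise non-isomorphic biased partitions of $\mathbb{Z}^n$.
   Context: $[k]=\{1,\dots,k\}$. $\mathbb{Z}^n$ is the graph with edges $\{x,x+e_i\}$; $\Gamma(x)=\{x\pm e_i:i\in[n]\}$. A partition $\{X_i\}_{i\in[2n]}$ of $\mathbb{Z}^n$ is biased if $|\Gamma(x)\cap X_i|=1$ for every $x\in\mathbb{Z}^n$ and every $i\in[2n]$. Two biased partitions $\{X_i\}_{i\in[2n]}$ and $\{Y_i\}_{i\in[2n]}$ are isomorphic if there are a graph automorphism $\phi:\mathbb{Z}^n\to\mathbb{Z}^n$ and a permutation $\sigma$ of $[2n]$ with $\phi(X_i)=Y_{\sigma(i)}$ for all $i$. -}

module Defs where

open import Data.Nat using (ℕ; _*_)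
open import Data.Integer using (ℤ; _+_; _-_; +_)
open import Data.Fin using (Fin)
open import Data.Vec using (Vec; updateAt)
open import Data.Bool using (Bool; true; false)
open import Data.Product using (Σ; ∃; ∃!; _×_; _,_)
open import Relation.Binary.PropositionalEquality using (_≡_)

Point : ℕ → Set
Point n = Vec ℤ n

nbr : ∀ {n} → Point n → Fin n → Bool → Point n
nbr x j true  = updateAt x j (λ z → z + + 1)
nbr x j false = updateAt x j (λ z → z - + 1)

Adj : ∀ {n} → Point n → Point n → Set
Adj {n} x y = Σ (Fin n) λ j → Σ Bool λ s → y ≡ nbr x j s

-- A partition {X_i}_{i ∈ [2n]} of ℤⁿ, given by its labelling c (x ∈ X_{c x}).
Labelling : ℕ → Set
Labelling n = Point n → Fin (2 * n)

-- Biased: for every x and every i, exactly one neighbour of x lies in X_i.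
-- (The 2n neighbours x ± e_j are pairwise distinct, so counting neighbours
-- is counting pairs (j , s).)
IsBiased : ∀ {n} → Labelling n → Set
IsBiased {n} c = ∀ (x : Point n) (i : Fin (2 * n)) →
  ∃! _≡_ (λ (js : Fin n × Bool) → c (nbr x (Data.Product.proj₁ js) (Data.Product.proj₂ js)) ≡ i)

record BiasedPartition (n : ℕ) : Set where
  field
    label  : Labelling n
    biased : IsBiased label
open BiasedPartition public

record Automorphism (n : ℕ) : Set where
  field
    fun     : Point n → Point n
    inv     : Point n → Point n
    inv-l   : ∀ x → inv (fun x) ≡ x
    inv-r   : ∀ x → fun (inv x) ≡ x
    adj-to  : ∀ x y → Adj x y → Adj (fun x) (fun y)
    adj-from : ∀ x y → Adj (fun x) (fun y) → Adj x y

record Perm (k : ℕ) : Set where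
  field
    fun   : Fin k → Fin k
    inv   : Fin k → Fin k
    inv-l : ∀ i → inv (fun i) ≡ i
    inv-r : ∀ i → fun (inv i) ≡ i

-- {X_i} ≅ {Y_i}: φ(X_i) = Y_{σ(i)} for all i; with φ bijective this is
-- equivalent to: y-label of φ x equals σ (x-label of x), for all x.
Isomorphic : ∀ {n} → BiasedPartition n → BiasedPartition n → Set
Isomorphic {n} P Q =
  Σ (Automorphism n) λ φ → Σ (Perm (2 * n)) λ σ →
    ∀ x → label Q (Automorphism.fun φ x) ≡ Perm.fun σ (label P x)

module Submission where

-- For n = m + 2 and every bit sequence a we build a biased partition P_a of
-- ℤⁿ from which a can be read off up to isomorphism; conversely a labelling
-- of ℤⁿ is determined by countably many bits.  Hence there are exactly 2^ℵ₀
-- isomorphism classes.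
--
-- From a we form a Boolean sequence β on ℤ whose runs of
-- constancy have the lengths len k = 2k + 2 + a k, and label
--   y ↦ W y + ⌊S y / 2⌋ + N · β ⌊(g y + 1) / 2⌋   (mod 2N),
-- where S y = Σ yᵢ, W y = Σ i · yᵢ and g y = y₀ - y_{N-1}.  Around every
-- point the 2N neighbours receive their labels through an explicit bijection,
-- so the partition is biased (biased-by-bijection).
--
-- A marker of length M is a straight ray with monochromatic edges
-- at positions 2i + 2 (i < M), bracketed by bichromatic edges at 0 and
-- 2M + 2; isomorphisms preserve markers (transport-marker).  Classifying the
-- monochromatic edges of P_b shows that a marker of length M ≥ 2 forces a run
-- of length M in β_b (marker⇒run-or-kinks), so M = len_b k′, while P_a
-- contains a marker of length len_a k.  Thus P_a ≅ P_b gives a = b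
-- (family-injective), and the theorem follows together with label-bits.

open import Defs
open import Data.Nat using (ℕ; _≤_)
open import Data.Bool using (Bool)
open import Data.Product using (Σ; _×_)
open import Relation.Binary.PropositionalEquality using (_≡_)

import Data.Nat as ℕ
open import Data.Nat using (zero; suc; NonZero)
import Data.Nat.Properties as ℕP
open import Data.Integer using (ℤ; +_; -[1+_]; _+_; _-_; _*_; -_)
import Data.Integer.Properties as ℤP
open import Data.Integer.DivMod using (_%ℕ_; _/ℕ_; n%ℕd<d; a≡a%ℕn+[a/ℕn]*n)
import Data.Nat.DivMod as ℕD
open import Data.Integer.Tactic.RingSolver using (solve-∀)
import Data.Nat.Tactic.RingSolver as ℕSolver
open import Data.Bool using (true; false; not; if_then_else_; T)
import Data.Bool.Properties as BP
open import Relation.Binary.PropositionalEquality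
  using (refl; sym; trans; cong; cong₂; subst; subst₂; _≢_; module ≡-Reasoning)
open import Algebra.Properties.AbelianGroup ℤP.+-0-abelianGroup using (∙-cancelˡ)
import Data.Fin as F
open import Data.Fin using (Fin; toℕ)
import Data.Fin.Properties as FP
open import Function.Bundles using (_↔_; mk↔ₛ′; Inverse)
open import Function.Construct.Composition using (_↔-∘_)
open import Data.Vec using ([]; _∷_; lookup; updateAt; replicate)
import Data.Vec.Properties as VP
open import Data.Product using (_,_; proj₁; proj₂)
open import Data.Product.Properties using (,-injective)
open import Relation.Nullary using (¬_; yes; no)
open import Relation.Nullary.Decidable using (⌊_⌋; toWitness; fromWitness)
open import Data.Empty using (⊥-elim)
open import Data.Sum using (_⊎_; inj₁; inj₂)
open import Relation.Binary.Definitions using (Tri; tri<; tri≈; tri>)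

bitℕ : Bool → ℕ
bitℕ false = 0
bitℕ true  = 1

bitℤ : Bool → ℤ
bitℤ b = + bitℕ b

bit-not : ∀ p → bitℤ p + bitℤ (not p) ≡ + 1
bit-not false = refl
bit-not true  = refl

-- Halving integers: w = 2 · half w + par w, with half rounding down.

halfℕ : ℕ → ℕ
halfℕ zero          = zero
halfℕ (suc zero)    = zero
halfℕ (suc (suc k)) = suc (halfℕ k)

parℕ : ℕ → Bool
parℕ zero          = false
parℕ (suc zero)    = true
parℕ (suc (suc k)) = parℕ k

half : ℤ → ℤ
half (+ k)    = + halfℕ k
half -[1+ k ] = -[1+ halfℕ k ]

par : ℤ → Bool
par (+ k)    = parℕ k
par -[1+ k ] = not (parℕ k)

halfℕ-suc : ∀ k → halfℕ (suc k) ≡ halfℕ k ℕ.+ bitℕ (parℕ k)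
halfℕ-suc zero          = refl
halfℕ-suc (suc zero)    = refl
halfℕ-suc (suc (suc k)) = cong suc (halfℕ-suc k)

parℕ-suc : ∀ k → parℕ (suc k) ≡ not (parℕ k)
parℕ-suc zero          = refl
parℕ-suc (suc zero)    = refl
parℕ-suc (suc (suc k)) = parℕ-suc k

halfℕ-double : ∀ k → halfℕ (k ℕ.+ k) ≡ k
halfℕ-double zero    = refl
halfℕ-double (suc k) rewrite ℕP.+-suc k k = cong suc (halfℕ-double k)

parℕ-double : ∀ k → parℕ (k ℕ.+ k) ≡ false
parℕ-double zero    = refl
parℕ-double (suc k) rewrite ℕP.+-suc k k = parℕ-double k

halfℕ-decomp : ∀ k → halfℕ k ℕ.+ halfℕ k ℕ.+ bitℕ (parℕ k) ≡ k
halfℕ-decomp zero          = refl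
halfℕ-decomp (suc zero)    = refl
halfℕ-decomp (suc (suc k)) rewrite ℕP.+-suc (halfℕ k) (halfℕ k) =
  cong (λ x → suc (suc x)) (halfℕ-decomp k)

halfℕ-2k+b : ∀ k b → halfℕ (k ℕ.+ k ℕ.+ bitℕ b) ≡ k
halfℕ-2k+b k false = trans (cong halfℕ (ℕP.+-identityʳ (k ℕ.+ k))) (halfℕ-double k)
halfℕ-2k+b k true  = begin
  halfℕ (k ℕ.+ k ℕ.+ 1)                            ≡⟨ cong halfℕ (ℕP.+-comm (k ℕ.+ k) 1) ⟩
  halfℕ (suc (k ℕ.+ k))                            ≡⟨ halfℕ-suc (k ℕ.+ k) ⟩
  halfℕ (k ℕ.+ k) ℕ.+ bitℕ (parℕ (k ℕ.+ k))        ≡⟨ cong₂ (λ h p → h ℕ.+ bitℕ p) (halfℕ-double k) (parℕ-double k) ⟩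
  k ℕ.+ 0                                          ≡⟨ ℕP.+-identityʳ k ⟩
  k                                                ∎
  where open ≡-Reasoning

parℕ-2k+b : ∀ k b → parℕ (k ℕ.+ k ℕ.+ bitℕ b) ≡ b
parℕ-2k+b k false = trans (cong parℕ (ℕP.+-identityʳ (k ℕ.+ k))) (parℕ-double k)
parℕ-2k+b k true  = trans (cong parℕ (ℕP.+-comm (k ℕ.+ k) 1)) (trans (parℕ-suc (k ℕ.+ k)) (cong not (parℕ-double k)))

2k+b-injective : ∀ {k k′ b b′} → k ℕ.+ k ℕ.+ bitℕ b ≡ k′ ℕ.+ k′ ℕ.+ bitℕ b′ → k ≡ k′ × b ≡ b′
2k+b-injective {k} {k′} {b} {b′} e =
  trans (sym (halfℕ-2k+b k b)) (trans (cong halfℕ e) (halfℕ-2k+b k′ b′)) ,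
  trans (sym (parℕ-2k+b k b)) (trans (cong parℕ e) (parℕ-2k+b k′ b′))

par-suc : ∀ w → par (w + + 1) ≡ not (par w)
par-suc (+ k) rewrite ℕP.+-comm k 1 = parℕ-suc k
par-suc -[1+ zero ]  = refl
par-suc -[1+ suc k ] rewrite parℕ-suc k = sym (BP.not-involutive (not (parℕ k)))

half-suc : ∀ w → half (w + + 1) ≡ half w + bitℤ (par w)
half-suc (+ k) rewrite ℕP.+-comm k 1 | halfℕ-suc k =
  ℤP.pos-+ (halfℕ k) (bitℕ (parℕ k))
half-suc -[1+ zero ] = refl
half-suc -[1+ suc k ] rewrite halfℕ-suc k | parℕ-suc k with parℕ k
... | false rewrite ℕP.+-identityʳ (halfℕ k) = refl
... | true  rewrite ℕP.+-comm (halfℕ k) 1    = refl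

par-pred : ∀ w → par (w - + 1) ≡ not (par w)
par-pred w = begin
  par (w - + 1)                   ≡⟨ BP.not-involutive (par (w - + 1)) ⟨
  not (not (par (w - + 1)))       ≡⟨ cong not (par-suc (w - + 1)) ⟨
  not (par (w - + 1 + + 1))       ≡⟨ cong (λ u → not (par u)) (down-up w) ⟩
  not (par w)                     ∎
  where
    open ≡-Reasoning
    down-up : ∀ w → w - + 1 + + 1 ≡ w
    down-up = solve-∀

half-pred : ∀ w → half (w - + 1) ≡ half w - bitℤ (not (par w))
half-pred w = begin
  half (w - + 1)                                 ≡⟨ add-sub (half (w - + 1)) (bitℤ (par (w - + 1))) ⟩
  half (w - + 1) + bitℤ (par (w - + 1)) - bitℤ (par (w - + 1))
                                                 ≡⟨ cong₂ (λ u p → u - bitℤ p) (sym (half-suc (w - + 1))) (par-pred w) ⟩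
  half (w - + 1 + + 1) - bitℤ (not (par w))      ≡⟨ cong (λ u → half u - bitℤ (not (par w))) (down-up w) ⟩
  half w - bitℤ (not (par w))                    ∎
  where
    open ≡-Reasoning
    add-sub : ∀ a b → a ≡ a + b - b
    add-sub = solve-∀
    down-up : ∀ w → w - + 1 + + 1 ≡ w
    down-up = solve-∀

half-double : ∀ u → half (u + u) ≡ u
half-double (+ k)    = cong +_ (halfℕ-double k)
half-double -[1+ k ] rewrite halfℕ-suc (k ℕ.+ k) | halfℕ-double k | parℕ-double k =
  cong -[1+_] (ℕP.+-identityʳ k)

par-double : ∀ u → par (u + u) ≡ false
par-double (+ k)    = parℕ-double k
par-double -[1+ k ] rewrite parℕ-suc (k ℕ.+ k) | parℕ-double k = refl

pos-2h+b : ∀ h b → + (h ℕ.+ h ℕ.+ b) ≡ + h + + h + + b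
pos-2h+b h b = trans (ℤP.pos-+ (h ℕ.+ h) b) (cong (_+ + b) (ℤP.pos-+ h h))

half-decomp : ∀ w → w ≡ half w + half w + bitℤ (par w)
half-decomp (+ k) = trans (cong +_ (sym (halfℕ-decomp k))) (pos-2h+b (halfℕ k) (bitℕ (parℕ k)))
half-decomp -[1+ k ] = negative (halfℕ k) (parℕ k) (halfℕ-decomp k)
  where
    open ≡-Reasoning
    neg : ∀ n → -[1+ n ] ≡ - + 1 - + n
    neg zero    = refl
    neg (suc n) = refl
    flip : ∀ x p → - + 1 - (x + x + bitℤ p) ≡ (- + 1 - x) + (- + 1 - x) + bitℤ (not p)
    flip x false = even x
      where even : ∀ x → - + 1 - (x + x + + 0) ≡ (- + 1 - x) + (- + 1 - x) + + 1
            even = solve-∀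
    flip x true = odd x
      where odd : ∀ x → - + 1 - (x + x + + 1) ≡ (- + 1 - x) + (- + 1 - x) + + 0
            odd = solve-∀
    negative : ∀ h p {k} → h ℕ.+ h ℕ.+ bitℕ p ≡ k →
               -[1+ k ] ≡ -[1+ h ] + -[1+ h ] + bitℤ (not p)
    negative h p refl = begin
      -[1+ h ℕ.+ h ℕ.+ bitℕ p ]                    ≡⟨ neg _ ⟩
      - + 1 - + (h ℕ.+ h ℕ.+ bitℕ p)               ≡⟨ cong (λ u → - + 1 - u) (pos-2h+b h (bitℕ p)) ⟩
      - + 1 - (+ h + + h + bitℤ p)                 ≡⟨ flip (+ h) p ⟩
      (- + 1 - + h) + (- + 1 - + h) + bitℤ (not p) ≡⟨ cong (λ u → u + u + bitℤ (not p)) (neg h) ⟨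
      -[1+ h ] + -[1+ h ] + bitℤ (not p)           ∎

sgn : Bool → ℤ
sgn true  = + 1
sgn false = - + 1

nbr-def : ∀ {n} (x : Point n) j s → nbr x j s ≡ updateAt x j (_+ sgn s)
nbr-def x j true  = refl
nbr-def x j false = refl

nbr-same : ∀ {n} (x : Point n) j s → lookup (nbr x j s) j ≡ lookup x j + sgn s
nbr-same x j s rewrite nbr-def x j s = VP.lookup∘updateAt j x

nbr-other : ∀ {n} (x : Point n) j i s → i ≢ j → lookup (nbr x j s) i ≡ lookup x i
nbr-other x j i s i≢j rewrite nbr-def x j s = VP.lookup∘updateAt′ i j i≢j x

nbr-comm : ∀ {n} (x : Point n) j j′ s s′ → j ≢ j′ →
           nbr (nbr x j s) j′ s′ ≡ nbr (nbr x j′ s′) j s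
nbr-comm x j j′ s s′ j≢j′
  rewrite nbr-def x j s | nbr-def x j′ s′
        | nbr-def (updateAt x j (_+ sgn s)) j′ s′ | nbr-def (updateAt x j′ (_+ sgn s′)) j s =
  VP.updateAt-commutes j′ j (λ e → j≢j′ (sym e)) x

nbr-back : ∀ {n} (x : Point n) j s → nbr (nbr x j s) j (not s) ≡ x
nbr-back x j s rewrite nbr-def x j s | nbr-def (updateAt x j (_+ sgn s)) j (not s) =
  trans (VP.updateAt-updateAt-local j x (cancel s (lookup x j))) (VP.updateAt-id j x)
  where
    up-down : ∀ a → a + + 1 + - + 1 ≡ a
    up-down = solve-∀
    down-up : ∀ a → a + - + 1 + + 1 ≡ a
    down-up = solve-∀
    cancel : ∀ s a → a + sgn s + sgn (not s) ≡ a
    cancel true  = up-down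
    cancel false = down-up

sgn-injective : ∀ {s s′} → sgn s ≡ sgn s′ → s ≡ s′
sgn-injective {true}  {true}  _ = refl
sgn-injective {false} {false} _ = refl
sgn-injective {true}  {false} ()
sgn-injective {false} {true}  ()

sgn≢0 : ∀ s → sgn s ≢ + 0
sgn≢0 true  ()
sgn≢0 false ()

nbr-injective : ∀ {n} (x : Point n) j j′ s s′ → nbr x j s ≡ nbr x j′ s′ → j ≡ j′ × s ≡ s′
nbr-injective x j j′ s s′ e with j F.≟ j′
... | yes refl = refl , sgn-injective (∙-cancelˡ (lookup x j) (sgn s) (sgn s′) (begin
  lookup x j + sgn s      ≡⟨ nbr-same x j s ⟨
  lookup (nbr x j s) j    ≡⟨ cong (λ v → lookup v j) e ⟩
  lookup (nbr x j s′) j   ≡⟨ nbr-same x j s′ ⟩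
  lookup x j + sgn s′     ∎))
  where open ≡-Reasoning
... | no j≢j′ = ⊥-elim (sgn≢0 s (∙-cancelˡ (lookup x j) (sgn s) (+ 0) (begin
  lookup x j + sgn s      ≡⟨ nbr-same x j s ⟨
  lookup (nbr x j s) j    ≡⟨ cong (λ v → lookup v j) e ⟩
  lookup (nbr x j′ s′) j  ≡⟨ nbr-other x j′ j s′ j≢j′ ⟩
  lookup x j              ≡⟨ ℤP.+-identityʳ (lookup x j) ⟨
  lookup x j + + 0        ∎)))
  where open ≡-Reasoning

OnlyMiddle : ∀ {n} → Point n → Point n → Point n → Set
OnlyMiddle y y′ z = ∀ w → Adj y w → Adj w z → w ≡ y′

nbr-back⁻ : ∀ {n} (x : Point n) j s → nbr (nbr x j (not s)) j s ≡ x
nbr-back⁻ x j s = trans (cong (nbr (nbr x j (not s)) j) (sym (BP.not-involutive s))) (nbr-back x j (not s))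

-- Two steps through an only common neighbour go in the same direction:
-- turning would give a second common neighbour (the other corner of the
-- square), and reversing would make every neighbour of y a common one.
straight-step : ∀ {n} (y : Point n) j s j′ s′ →
  OnlyMiddle y (nbr y j s) (nbr (nbr y j s) j′ s′) → j′ ≡ j × s′ ≡ s
straight-step y j s j′ s′ only with j F.≟ j′
... | no j≢j′ = ⊥-elim (j≢j′ (sym (proj₁ (nbr-injective y j′ j s′ s corner))))
  where
    corner : nbr y j′ s′ ≡ nbr y j s
    corner = only (nbr y j′ s′) (j′ , s′ , refl) (j , s , nbr-comm y j j′ s s′ j≢j′)
... | yes refl with s′ BP.≟ s
...   | yes s′≡s = refl , s′≡s
...   | no s′≢s = ⊥-elim (BP.not-¬ refl (sym (proj₂ (nbr-injective y j j (not s) s behind))))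
  where
    back : nbr (nbr y j s) j s′ ≡ y
    back = trans (cong (nbr (nbr y j s) j) (BP.¬-not s′≢s)) (nbr-back y j s)
    behind : nbr y j (not s) ≡ nbr y j s
    behind = only (nbr y j (not s)) (j , not s , refl) (j , s , trans back (sym (nbr-back⁻ y j s)))

record StraightLine {n} (z : ℕ → Point n) (j : Fin n) (s : Bool) : Set where
  constructor straight
  field moves : ∀ i → z (suc i) ≡ nbr (z i) j s
open StraightLine public

straight-line : ∀ {n} (z : ℕ → Point n) →
  (∀ i → Adj (z i) (z (suc i))) → (∀ i → OnlyMiddle (z i) (z (suc i)) (z (suc (suc i)))) →
  Σ (Fin n) λ j → Σ Bool λ s → StraightLine z j s
straight-line z adj only = j₀ , s₀ , straight λ i → trans (step-eq i) (cong₂ (nbr (z i)) (proj₁ (same i)) (proj₂ (same i)))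
  where
    dir : ∀ i → Fin _
    dir i = proj₁ (adj i)
    sign : ∀ i → Bool
    sign i = proj₁ (proj₂ (adj i))
    j₀ : Fin _
    j₀ = dir 0
    s₀ : Bool
    s₀ = sign 0
    step-eq : ∀ i → z (suc i) ≡ nbr (z i) (dir i) (sign i)
    step-eq i = proj₂ (proj₂ (adj i))
    same : ∀ i → dir i ≡ j₀ × sign i ≡ s₀
    same zero = refl , refl
    same (suc i) with straight-step (z i) (dir i) (sign i) (dir (suc i)) (sign (suc i))
                        (subst₂ (OnlyMiddle (z i)) (step-eq i) two-steps (only i))
      where
        two-steps : z (suc (suc i)) ≡ nbr (nbr (z i) (dir i) (sign i)) (dir (suc i)) (sign (suc i))
        two-steps = trans (step-eq (suc i)) (cong (λ u → nbr u (dir (suc i)) (sign (suc i))) (step-eq i))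
    ... | d , s = trans d (proj₁ (same i)) , trans s (proj₂ (same i))

sgn-sum-double : ∀ a b s → sgn a + sgn b ≡ sgn s + sgn s → a ≡ s
sgn-sum-double true  true  true  _ = refl
sgn-sum-double false false false _ = refl
sgn-sum-double true  false true  ()
sgn-sum-double true  false false ()
sgn-sum-double false true  true  ()
sgn-sum-double false true  false ()
sgn-sum-double true  true  false ()
sgn-sum-double false false true  ()

sgn≢double : ∀ a s → sgn a ≢ sgn s + sgn s
sgn≢double true  true  ()
sgn≢double true  false ()
sgn≢double false true  ()
sgn≢double false false ()

0≢double : ∀ s → + 0 ≢ sgn s + sgn s
0≢double true  ()
0≢double false ()

-- Conversely, on a straight segment y, y ± e_j, y ± 2e_j the middle point is
-- the only common neighbour of the ends: the j-th coordinate must move by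
-- ±2 in two unit steps.
segment-only-middle : ∀ {n} (y : Point n) j s → OnlyMiddle y (nbr y j s) (nbr (nbr y j s) j s)
segment-only-middle y j s w (j₁ , s₁ , refl) (j₂ , s₂ , ends) = cong₂ (nbr y) (proj₁ first-step) (proj₂ first-step)
  where
    open ≡-Reasoning
    yj : ℤ
    yj = lookup y j
    along : yj + (sgn s + sgn s) ≡ lookup (nbr (nbr y j₁ s₁) j₂ s₂) j
    along = begin
      yj + (sgn s + sgn s)                 ≡⟨ ℤP.+-assoc yj (sgn s) (sgn s) ⟨
      yj + sgn s + sgn s                   ≡⟨ cong (_+ sgn s) (nbr-same y j s) ⟨
      lookup (nbr y j s) j + sgn s         ≡⟨ nbr-same (nbr y j s) j s ⟨
      lookup (nbr (nbr y j s) j s) j       ≡⟨ cong (λ v → lookup v j) ends ⟩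
      lookup (nbr (nbr y j₁ s₁) j₂ s₂) j   ∎
    first-step : j₁ ≡ j × s₁ ≡ s
    first-step with j₁ F.≟ j | j₂ F.≟ j
    ... | yes refl | yes refl = refl , sgn-sum-double s₁ s₂ s (sym (∙-cancelˡ yj _ _ (trans along (begin
      lookup (nbr (nbr y j s₁) j s₂) j     ≡⟨ nbr-same (nbr y j s₁) j s₂ ⟩
      lookup (nbr y j s₁) j + sgn s₂       ≡⟨ cong (_+ sgn s₂) (nbr-same y j s₁) ⟩
      yj + sgn s₁ + sgn s₂                 ≡⟨ ℤP.+-assoc yj (sgn s₁) (sgn s₂) ⟩
      yj + (sgn s₁ + sgn s₂)               ∎))))
    ... | yes refl | no j₂≢j = ⊥-elim (sgn≢double s₁ s (sym (∙-cancelˡ yj _ _ (trans along (begin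
      lookup (nbr (nbr y j s₁) j₂ s₂) j    ≡⟨ nbr-other (nbr y j s₁) j₂ j s₂ (λ e → j₂≢j (sym e)) ⟩
      lookup (nbr y j s₁) j                ≡⟨ nbr-same y j s₁ ⟩
      yj + sgn s₁                          ∎)))))
    ... | no j₁≢j | yes refl = ⊥-elim (sgn≢double s₂ s (sym (∙-cancelˡ yj _ _ (trans along (begin
      lookup (nbr (nbr y j₁ s₁) j s₂) j    ≡⟨ nbr-same (nbr y j₁ s₁) j s₂ ⟩
      lookup (nbr y j₁ s₁) j + sgn s₂      ≡⟨ cong (_+ sgn s₂) (nbr-other y j₁ j s₁ (λ e → j₁≢j (sym e))) ⟩
      yj + sgn s₂                          ∎)))))
    ... | no j₁≢j | no j₂≢j = ⊥-elim (0≢double s (sym (∙-cancelˡ yj _ _ (trans along (begin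
      lookup (nbr (nbr y j₁ s₁) j₂ s₂) j   ≡⟨ nbr-other (nbr y j₁ s₁) j₂ j s₂ (λ e → j₂≢j (sym e)) ⟩
      lookup (nbr y j₁ s₁) j               ≡⟨ nbr-other y j₁ j s₁ (λ e → j₁≢j (sym e)) ⟩
      yj                                   ≡⟨ ℤP.+-identityʳ yj ⟨
      yj + + 0                             ∎)))))

-- Markers: an isomorphism invariant of labellings

twice+2 : ℕ → ℕ
twice+2 i = suc (suc (i ℕ.+ i))

record Marker {n} (c : Labelling n) (M : ℕ) : Set where
  field
    ray   : ℕ → Point n
    step  : ∀ i → Adj (ray i) (ray (suc i))
    only  : ∀ i → OnlyMiddle (ray i) (ray (suc i)) (ray (suc (suc i)))
    mono  : ∀ i → i ℕ.< M → c (ray (twice+2 i)) ≡ c (ray (suc (twice+2 i)))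
    start : c (ray 0) ≢ c (ray 1)
    stop  : c (ray (twice+2 M)) ≢ c (ray (suc (twice+2 M)))

-- Isomorphisms map markers to markers of the same length: φ preserves and
-- reflects adjacency (so rays and only-middles), and σ preserves and
-- reflects equality of labels.
transport-marker : ∀ {n} (P Q : BiasedPartition n) M → Isomorphic P Q →
                   Marker (label P) M → Marker (label Q) M
transport-marker P Q M (φ , σ , relabel) mk = record
  { ray   = λ i → f (ray i)
  ; step  = λ i → adj-to _ _ (step i)
  ; only  = only′
  ; mono  = λ i i<M → trans (relabel _) (trans (cong (Perm.fun σ) (mono i i<M)) (sym (relabel _)))
  ; start = distinct start
  ; stop  = distinct stop
  }
  where
    open Marker mk
    open Automorphism φ renaming (fun to f)
    only′ : ∀ i → OnlyMiddle (f (ray i)) (f (ray (suc i))) (f (ray (suc (suc i))))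
    only′ i w a₁ a₂ = trans (sym (inv-r w)) (cong f (only i (inv w)
      (adj-from _ _ (subst (Adj (f (ray i))) (sym (inv-r w)) a₁))
      (adj-from _ _ (subst (λ u → Adj u (f (ray (suc (suc i))))) (sym (inv-r w)) a₂))))
    distinct : ∀ {a b} → label P a ≢ label P b → label Q (f a) ≢ label Q (f b)
    distinct {a} {b} ne e = ne (begin
      label P a                           ≡⟨ Perm.inv-l σ _ ⟨
      Perm.inv σ (Perm.fun σ (label P a)) ≡⟨ cong (Perm.inv σ) (trans (sym (relabel a)) (trans e (relabel b))) ⟩
      Perm.inv σ (Perm.fun σ (label P b)) ≡⟨ Perm.inv-l σ _ ⟩
      label P b                           ∎)
      where open ≡-Reasoning

infix 4 _≈_mod_
record _≈_mod_ (a b : ℤ) (d : ℕ) : Set where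
  constructor multiple
  field
    quotient : ℤ
    differ   : a ≡ b + quotient * + d

≡⇒mod : ∀ {d a b} → a ≡ b → a ≈ b mod d
≡⇒mod {b = b} a≡b = multiple (+ 0) (trans a≡b (sym (ℤP.+-identityʳ b)))

mod-trans : ∀ {d a b c} → a ≈ b mod d → b ≈ c mod d → a ≈ c mod d
mod-trans {d} {c = c} (multiple q a≡b+qd) (multiple q′ b≡c+q′d) =
  multiple (q′ + q) (trans a≡b+qd (trans (cong (_+ q * + d) b≡c+q′d) (regroup c q′ q (+ d))))
  where regroup : ∀ c x y D → c + x * D + y * D ≡ c + (x + y) * D
        regroup = solve-∀

mod-+ˡ : ∀ {d a b} c → a ≈ b mod d → c + a ≈ c + b mod d
mod-+ˡ {d} {b = b} c (multiple q a≡b+qd) =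
  multiple q (trans (cong (λ u → c + u) a≡b+qd) (sym (ℤP.+-assoc c b (q * + d))))

mod-+ʳ : ∀ {d a b} c → a ≈ b mod d → a + c ≈ b + c mod d
mod-+ʳ {d} {a} {b} c a≈b = subst₂ (λ u v → u ≈ v mod d) (ℤP.+-comm c a) (ℤP.+-comm c b) (mod-+ˡ c a≈b)

remainderℕ-unique : ∀ d .{{_ : NonZero d}} {r r′} k → r ℕ.< d → r′ ℕ.< d →
                    r ℕ.+ k ℕ.* d ≡ r′ → r ≡ r′
remainderℕ-unique d {r} {r′} k r<d r′<d e = begin
  r                     ≡⟨ ℕD.m<n⇒m%n≡m r<d ⟨
  r ℕ.% d               ≡⟨ ℕD.[m+kn]%n≡m%n r k d ⟨
  (r ℕ.+ k ℕ.* d) ℕ.% d ≡⟨ cong (ℕ._% d) e ⟩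
  r′ ℕ.% d              ≡⟨ ℕD.m<n⇒m%n≡m r′<d ⟩
  r′                    ∎
  where open ≡-Reasoning

remainder-unique : ∀ d .{{_ : NonZero d}} {r r′} t → r ℕ.< d → r′ ℕ.< d →
                   + r + t * + d ≡ + r′ → r ≡ r′
remainder-unique d {r} (+ k) r<d r′<d e =
  remainderℕ-unique d k r<d r′<d (ℤP.+-injective (trans (pos-lin r k d) e))
  where pos-lin : ∀ r k d → + (r ℕ.+ k ℕ.* d) ≡ + r + + k * + d
        pos-lin r k d = trans (ℤP.pos-+ r (k ℕ.* d)) (cong (λ u → + r + u) (ℤP.pos-* k d))
remainder-unique d {r} {r′} -[1+ k ] r<d r′<d e =
  sym (remainderℕ-unique d (suc k) r′<d r<d (ℤP.+-injective (begin
    + (r′ ℕ.+ suc k ℕ.* d)           ≡⟨ ℤP.pos-+ r′ (suc k ℕ.* d) ⟩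
    + r′ + + (suc k ℕ.* d)           ≡⟨ cong (λ u → u + + (suc k ℕ.* d)) e ⟨
    + r + -[1+ k ] * + d + + (suc k ℕ.* d)
                                     ≡⟨ cong (λ u → + r + -[1+ k ] * + d + u) (ℤP.pos-* (suc k) d) ⟩
    + r + -[1+ k ] * + d + + suc k * + d
                                     ≡⟨ cancel (+ r) (+ suc k) (+ d) ⟩
    + r                              ∎)))
  where
    open ≡-Reasoning
    -- -[1+ k ] is - (+ suc k) definitionally.
    cancel : ∀ r K D → r + (- K) * D + K * D ≡ r
    cancel = solve-∀

mod⇒%-equal : ∀ d .{{_ : NonZero d}} {a b} → a ≈ b mod d → a %ℕ d ≡ b %ℕ d
mod⇒%-equal d {a} {b} (multiple q a≡b+qd) =
  remainder-unique d (a /ℕ d - (b /ℕ d + q)) (n%ℕd<d a d) (n%ℕd<d b d) (begin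
    + (a %ℕ d) + (a /ℕ d - (b /ℕ d + q)) * + d
        ≡⟨ shuffle (+ (a %ℕ d)) (a /ℕ d) (b /ℕ d) q (+ d) ⟩
    + (a %ℕ d) + a /ℕ d * + d - q * + d - b /ℕ d * + d
        ≡⟨ cong (λ u → u - q * + d - b /ℕ d * + d) (sym (a≡a%ℕn+[a/ℕn]*n a d)) ⟩
    a - q * + d - b /ℕ d * + d
        ≡⟨ cong (λ u → u - q * + d - b /ℕ d * + d) a≡b+qd ⟩
    b + q * + d - q * + d - b /ℕ d * + d
        ≡⟨ cong (λ u → u + q * + d - q * + d - b /ℕ d * + d) (a≡a%ℕn+[a/ℕn]*n b d) ⟩
    + (b %ℕ d) + b /ℕ d * + d + q * + d - q * + d - b /ℕ d * + d
        ≡⟨ cancel (+ (b %ℕ d)) (b /ℕ d * + d) (q * + d) ⟩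
    + (b %ℕ d) ∎)
  where
    open ≡-Reasoning
    shuffle : ∀ r x y q D → r + (x - (y + q)) * D ≡ r + x * D - q * D - y * D
    shuffle = solve-∀
    cancel : ∀ r X Q → r + X + Q - Q - X ≡ r
    cancel = solve-∀

reduce : ∀ d .{{_ : NonZero d}} → ℤ → Fin d
reduce d a = F.fromℕ< (n%ℕd<d a d)

reduce-cong : ∀ d .{{_ : NonZero d}} {a b} → a ≈ b mod d → reduce d a ≡ reduce d b
reduce-cong d {a} {b} a≈b = FP.fromℕ<-cong (a %ℕ d) (b %ℕ d) (mod⇒%-equal d a≈b) _ _

reduce-toℕ : ∀ d .{{_ : NonZero d}} (i : Fin d) → reduce d (+ toℕ i) ≡ i
reduce-toℕ d i = FP.toℕ-injective (trans (FP.toℕ-fromℕ< _) (ℕD.m<n⇒m%n≡m (FP.toℕ<n i)))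

reduce-spec : ∀ d .{{_ : NonZero d}} a → + toℕ (reduce d a) ≈ a mod d
reduce-spec d a = multiple (- (a /ℕ d)) (begin
  + toℕ (reduce d a)                      ≡⟨ cong +_ (FP.toℕ-fromℕ< _) ⟩
  + (a %ℕ d)                              ≡⟨ undo (+ (a %ℕ d)) (a /ℕ d) (+ d) ⟩
  + (a %ℕ d) + a /ℕ d * + d + - (a /ℕ d) * + d
                                          ≡⟨ cong (λ u → u + - (a /ℕ d) * + d) (a≡a%ℕn+[a/ℕn]*n a d) ⟨
  a + - (a /ℕ d) * + d                    ∎)
  where
    open ≡-Reasoning
    undo : ∀ r q D → r ≡ r + q * D + (- q) * D
    undo = solve-∀

shift : ∀ d .{{_ : NonZero d}} → ℤ → Fin d ↔ Fin d
shift d b = mk↔ₛ′ (λ i → reduce d (b + + toℕ i)) (λ i → reduce d (+ toℕ i - b)) there-back back-there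
  where
    there-back : ∀ i → reduce d (b + + toℕ (reduce d (+ toℕ i - b))) ≡ i
    there-back i = trans (reduce-cong d (mod-trans (mod-+ˡ b (reduce-spec d (+ toℕ i - b))) (≡⇒mod (add-sub b (+ toℕ i)))))
                         (reduce-toℕ d i)
      where add-sub : ∀ b i → b + (i - b) ≡ i
            add-sub = solve-∀
    back-there : ∀ i → reduce d (+ toℕ (reduce d (b + + toℕ i)) - b) ≡ i
    back-there i = trans (reduce-cong d (mod-trans (mod-+ʳ (- b) (reduce-spec d (b + + toℕ i)))
                                                   (≡⇒mod (add-sub b (+ toℕ i)))))
                         (reduce-toℕ d i)
      where add-sub : ∀ b i → b + i - b ≡ i
            add-sub = solve-∀

biased-by-bijection : ∀ {n} (c : Labelling n) →
  (∀ x → Σ ((Fin n × Bool) ↔ Fin (2 ℕ.* n)) λ b → ∀ j s → c (nbr x j s) ≡ Inverse.to b (j , s)) →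
  IsBiased c
biased-by-bijection c around x i = from i , hit , unique
  where
    open Inverse (proj₁ (around x))
    labels : ∀ j s → c (nbr x j s) ≡ to (j , s)
    labels = proj₂ (around x)
    hit : c (nbr x (proj₁ (from i)) (proj₂ (from i))) ≡ i
    hit = trans (labels _ _) (strictlyInverseˡ i)
    unique : ∀ {js} → c (nbr x (proj₁ js) (proj₂ js)) ≡ i → from i ≡ js
    unique {j , s} h = trans (cong from (trans (sym h) (labels j s))) (strictlyInverseʳ (j , s))

coordSum : ∀ {n} → Point n → ℤ
coordSum []      = + 0
coordSum (a ∷ v) = a + coordSum v

-- W x = Σ i · x_i.
weightedSum : ∀ {n} → Point n → ℤ
weightedSum []      = + 0
weightedSum (a ∷ v) = weightedSum v + coordSum v

coordSum-update : ∀ {n} (x : Point n) j c → coordSum (updateAt x j (_+ c)) ≡ coordSum x + c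
coordSum-update (a ∷ v) F.zero c = swap a (coordSum v) c
  where swap : ∀ a b c → a + c + b ≡ a + b + c
        swap = solve-∀
coordSum-update (a ∷ v) (F.suc j) c =
  trans (cong (λ t → a + t) (coordSum-update v j c)) (sym (ℤP.+-assoc a (coordSum v) c))

weightedSum-update : ∀ {n} (x : Point n) j c →
                     weightedSum (updateAt x j (_+ c)) ≡ weightedSum x + + toℕ j * c
weightedSum-update (a ∷ v) F.zero c = pad (weightedSum v + coordSum v) c
  where pad : ∀ a c → a ≡ a + + 0 * c
        pad = solve-∀
weightedSum-update (a ∷ v) (F.suc j) c
  rewrite weightedSum-update v j c | coordSum-update v j c =
  regroup (weightedSum v) (+ toℕ j) c (coordSum v)
  where regroup : ∀ w t c s → w + t * c + (s + c) ≡ w + s + (+ 1 + t) * c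
        regroup = solve-∀

coordSum-zeros : ∀ n → coordSum (replicate n (+ 0)) ≡ + 0
coordSum-zeros zero    = refl
coordSum-zeros (suc n) = trans (ℤP.+-identityˡ _) (coordSum-zeros n)

coordSum-nbr : ∀ {n} (x : Point n) j s → coordSum (nbr x j s) ≡ coordSum x + sgn s
coordSum-nbr x j s rewrite nbr-def x j s = coordSum-update x j (sgn s)

weightedSum-nbr : ∀ {n} (x : Point n) j s → weightedSum (nbr x j s) ≡ weightedSum x + + toℕ j * sgn s
weightedSum-nbr x j s rewrite nbr-def x j s = weightedSum-update x j (sgn s)

par-nbr : ∀ {n} (y : Point n) j s → par (coordSum (nbr y j s)) ≡ not (par (coordSum y))
par-nbr y j true  = trans (cong par (coordSum-nbr y j true)) (par-suc (coordSum y))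
par-nbr y j false = trans (cong par (coordSum-nbr y j false)) (par-pred (coordSum y))

par-along : ∀ {n} {z : ℕ → Point n} {j s} → StraightLine z j s →
            ∀ i → par (coordSum (z (twice+2 i))) ≡ par (coordSum (z 0))
par-along {z = z} {j} {s} line = even
  where
    two-steps : ∀ t → par (coordSum (z (suc (suc t)))) ≡ par (coordSum (z t))
    two-steps t = begin
      par (coordSum (z (suc (suc t))))     ≡⟨ cong (λ u → par (coordSum u)) (moves line (suc t)) ⟩
      par (coordSum (nbr (z (suc t)) j s)) ≡⟨ par-nbr (z (suc t)) j s ⟩
      not (par (coordSum (z (suc t))))     ≡⟨ cong (λ u → not (par (coordSum u))) (moves line t) ⟩
      not (par (coordSum (nbr (z t) j s))) ≡⟨ cong not (par-nbr (z t) j s) ⟩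
      not (not (par (coordSum (z t))))     ≡⟨ BP.not-involutive _ ⟩
      par (coordSum (z t))                 ∎
      where open ≡-Reasoning
    even : ∀ i → par (coordSum (z (twice+2 i))) ≡ par (coordSum (z 0))
    even zero    = two-steps 0
    even (suc i) = trans (cong (λ k → par (coordSum (z (suc (suc (suc k)))))) (ℕP.+-suc i i))
                         (trans (two-steps (twice+2 i)) (even i))

Steady : (ℤ → Bool) → ℤ → Set
Steady f w = f (w + + 1) ≡ f w

Run₁ : (ℤ → Bool) → ℕ → Set
Run₁ f M = Σ ℤ λ u → ¬ Steady f u × (∀ i → i ℕ.< M → Steady f (u + + suc i)) × ¬ Steady f (u + + suc M)

Run₂ : (ℤ → Bool) → ℕ → Set
Run₂ f M = Σ ℤ λ w → ¬ Steady f w × (∀ i → i ℕ.< M → Steady f (w + + twice+2 i)) × ¬ Steady f (w + + twice+2 M)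

DescendingRun₂ : (ℤ → Bool) → ℕ → Set
DescendingRun₂ f M =
  Σ ℤ λ v → ¬ Steady f v × (∀ i → i ℕ.< M → Steady f (v - + twice+2 i)) × ¬ Steady f (v - + twice+2 M)

-- Reading it forwards from v - (2M + 2), the i-th steady point is the
-- (M - 1 - i)-th one counted from v.
descending⇒run₂ : ∀ f M → DescendingRun₂ f M → Run₂ f M
descending⇒run₂ f M (v , ¬st₀ , steady , ¬st₁) =
  v - + twice+2 M , ¬st₁ , forwards , λ st → ¬st₀ (subst (Steady f) (back v (+ twice+2 M)) st)
  where
    back : ∀ v A → v - A + A ≡ v
    back = solve-∀
    forwards : ∀ i → i ℕ.< M → Steady f (v - + twice+2 M + + twice+2 i)
    forwards i i<M = subst (Steady f) position (steady i′ (ℕP.∸-monoʳ-< {o = 0} (ℕ.s≤s ℕ.z≤n) i<M))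
      where
        i′ : ℕ
        i′ = M ℕ.∸ suc i
        split : twice+2 M ≡ twice+2 i ℕ.+ twice+2 i′
        split = trans (cong twice+2 (sym (ℕP.m+[n∸m]≡n i<M))) (regroup i i′)
          where regroup : ∀ i j → suc (suc ((suc i ℕ.+ j) ℕ.+ (suc i ℕ.+ j)))
                                ≡ suc (suc (i ℕ.+ i)) ℕ.+ suc (suc (j ℕ.+ j))
                regroup = ℕSolver.solve-∀
        position : v - + twice+2 i′ ≡ v - + twice+2 M + + twice+2 i
        position = trans (cancel v (+ twice+2 i) (+ twice+2 i′))
                         (cong (λ A → v - A + + twice+2 i)
                               (trans (sym (ℤP.pos-+ (twice+2 i) (twice+2 i′))) (cong +_ (sym split))))
          where cancel : ∀ v A B → v - B ≡ v - (A + B) + A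
                cancel = solve-∀

Kinks₁ : (ℤ → Bool) → Set
Kinks₁ f = Σ ℤ λ u → ¬ Steady f u × ¬ Steady f (u + + 1)

Kinks₂ : (ℤ → Bool) → Set
Kinks₂ f = Σ ℤ λ w → ¬ Steady f w × ¬ Steady f (w + + 2)

double-shift : ∀ u i → u + u + + twice+2 i ≡ (u + + suc i) + (u + + suc i)
double-shift u i = trans (cong (λ t → u + u + t) pos-twice+2) (regroup u (+ suc i))
  where
    pos-twice+2 : + twice+2 i ≡ + suc i + + suc i
    pos-twice+2 = trans (cong (λ k → + suc k) (sym (ℕP.+-suc i i))) (ℤP.pos-+ (suc i) (suc i))
    regroup : ∀ u X → u + u + (X + X) ≡ (u + X) + (u + X)
    regroup = solve-∀

-- spread β w = β ⌊(w + 1)/2⌋ takes the values β u at 2u - 1 and 2u.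
spread : (ℤ → Bool) → ℤ → Bool
spread β w = β (half (w + + 1))

module _ (β : ℤ → Bool) where

  private
    half-2u+1 : ∀ u → half (u + u + + 1) ≡ u
    half-2u+1 u = trans (half-suc (u + u)) (trans (cong₂ (λ a b → a + bitℤ b) (half-double u) (par-double u))
                                                  (ℤP.+-identityʳ u))
    par-2u+1 : ∀ u → par (u + u + + 1) ≡ true
    par-2u+1 u = trans (par-suc (u + u)) (cong not (par-double u))
    half-2u+2 : ∀ u → half (u + u + + 1 + + 1) ≡ u + + 1
    half-2u+2 u = trans (half-suc (u + u + + 1)) (cong₂ (λ a b → a + bitℤ b) (half-2u+1 u) (par-2u+1 u))
    half-2u+3 : ∀ u → half (u + u + + 1 + + 1 + + 1) ≡ u + + 1
    half-2u+3 u = trans (half-suc (u + u + + 1 + + 1))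
      (trans (cong₂ (λ a b → a + bitℤ b) (half-2u+2 u) (trans (par-suc (u + u + + 1)) (cong not (par-2u+1 u))))
             (ℤP.+-identityʳ (u + + 1)))

  spread-steady-odd : ∀ u → Steady (spread β) (u + u + + 1)
  spread-steady-odd u = cong β (trans (half-2u+3 u) (sym (half-2u+2 u)))

  spread-steady-even⇒ : ∀ u → Steady (spread β) (u + u) → Steady β u
  spread-steady-even⇒ u st = trans (cong β (sym (half-2u+2 u))) (trans st (cong β (half-2u+1 u)))

  spread-steady-even⇐ : ∀ u → Steady β u → Steady (spread β) (u + u)
  spread-steady-even⇐ u st = trans (cong β (half-2u+2 u)) (trans st (cong β (sym (half-2u+1 u))))

  unsteady-spread : ∀ w → ¬ Steady (spread β) w → Σ ℤ λ u → w ≡ u + u × ¬ Steady β u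
  unsteady-spread w ¬st with par w in parity
  ... | false = half w , w-even , λ st → ¬st (subst (Steady (spread β)) (sym w-even) (spread-steady-even⇐ (half w) st))
    where w-even : w ≡ half w + half w
          w-even = trans (half-decomp w) (trans (cong (λ b → half w + half w + bitℤ b) parity) (ℤP.+-identityʳ _))
  ... | true = ⊥-elim (¬st (subst (Steady (spread β)) (sym w-odd) (spread-steady-odd (half w))))
    where w-odd : w ≡ half w + half w + + 1
          w-odd = trans (half-decomp w) (cong (λ b → half w + half w + bitℤ b) parity)

  private
    steady-at : ∀ u i → Steady (spread β) (u + u + + twice+2 i) → Steady β (u + + suc i)
    steady-at u i st = spread-steady-even⇒ (u + + suc i) (subst (Steady (spread β)) (double-shift u i) st)

  run₂⇒run₁ : ∀ M → Run₂ (spread β) M → Run₁ β M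
  run₂⇒run₁ M (w , ¬st₀ , steady , ¬st₁) with unsteady-spread w ¬st₀
  ... | u , refl , ¬stu = u , ¬stu , (λ i i<M → steady-at u i (steady i i<M)) , λ st → ¬st₁
        (subst (Steady (spread β)) (sym (double-shift u M)) (spread-steady-even⇐ (u + + suc M) st))

  kinks₂⇒kinks₁ : Kinks₂ (spread β) → Kinks₁ β
  kinks₂⇒kinks₁ (w , ¬st₀ , ¬st₁) with unsteady-spread w ¬st₀
  ... | u , refl , ¬stu = u , ¬stu , λ st → ¬st₁
        (subst (Steady (spread β)) (sym (double-shift u 0)) (spread-steady-even⇐ (u + + 1) st))

opposite-eq : ∀ {n} {j k : Fin n} → F.opposite j ≡ k → j ≡ F.opposite k
opposite-eq {j = j} e = trans (sym (FP.opposite-involutive j)) (cong F.opposite e)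

-- The construction: a biased partition of ℤᴺ (N ≥ 2) encoding β

module Construction (m : ℕ) (β : ℤ → Bool) where

  N : ℕ
  N = suc (suc m)

  D : ℕ
  D = 2 ℕ.* N

  last : Fin N
  last = F.fromℕ (suc m)

  -- g y = y₀ - y_{N-1}: the direction along which β is written.
  g : Point N → ℤ
  g y = lookup y F.zero - lookup y last

  φ : ℤ → Bool
  φ = spread β

  high : Bool → ℤ
  high false = + 0
  high true  = + N

  rawLabel : Point N → ℤ
  rawLabel y = weightedSum y + half (coordSum y) + high (φ (g y))

  lab : Labelling N
  lab y = reduce D (rawLabel y)

  -- The neighbours of x are labelled relative to the origin W x + ⌈S x / 2⌉.
  origin : Point N → ℤ
  origin x = weightedSum x + half (coordSum x) + bitℤ (par (coordSum x))

  zero≢last : F.zero ≢ last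
  zero≢last ()

  g-first : ∀ y s → g (nbr y F.zero s) ≡ g y + sgn s
  g-first y s rewrite nbr-same y F.zero s | nbr-other y F.zero last s (λ e → zero≢last (sym e)) =
    reorder (lookup y F.zero) (lookup y last) (sgn s)
    where reorder : ∀ a b c → a + c - b ≡ a - b + c
          reorder = solve-∀

  g-last : ∀ y s → g (nbr y last s) ≡ g y - sgn s
  g-last y s rewrite nbr-same y last s | nbr-other y last F.zero s zero≢last =
    reorder (lookup y F.zero) (lookup y last) (sgn s)
    where reorder : ∀ a b c → a - (b + c) ≡ a - b - c
          reorder = solve-∀

  g-middle : ∀ y j s → F.zero ≢ j → last ≢ j → g (nbr y j s) ≡ g y
  g-middle y j s zero≢j last≢j rewrite nbr-other y j F.zero s zero≢j | nbr-other y j last s last≢j = refl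

  g-last⁻ : ∀ y → g (nbr y last false) ≡ g y + + 1
  g-last⁻ y = trans (g-last y false) (minus-minus (g y))
    where minus-minus : ∀ a → a - - + 1 ≡ a + + 1
          minus-minus = solve-∀

  -- Reversing the axes exchanges the first and the last one, so stepping
  -- down along opposite k changes g as stepping up along k does.
  g-opposite : ∀ x k → g (nbr x (F.opposite k) false) ≡ g (nbr x k true)
  g-opposite x k with F.zero F.≟ k | last F.≟ k
  ... | yes refl | _ = trans (g-last⁻ x) (sym (g-first x true))
  ... | no _ | yes refl rewrite FP.opposite-involutive {n = N} F.zero =
    trans (g-first x false) (sym (g-last x true))
  ... | no zero≢k | no last≢k =
    trans (g-middle x (F.opposite k) false zero≢k′ last≢k′) (sym (g-middle x k true zero≢k last≢k))
    where
      zero≢k′ : F.zero ≢ F.opposite k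
      zero≢k′ e = last≢k (trans (cong F.opposite e) (FP.opposite-involutive k))
      last≢k′ : last ≢ F.opposite k
      last≢k′ e = zero≢k (trans (sym (FP.opposite-involutive {n = N} F.zero))
                                (trans (cong F.opposite e) (FP.opposite-involutive k)))

  rawLabel-up : ∀ x j → rawLabel (nbr x j true) ≡ origin x + + toℕ j + high (φ (g (nbr x j true)))
  rawLabel-up x j = begin
    weightedSum (nbr x j true) + half (coordSum (nbr x j true)) + h
      ≡⟨ cong₂ (λ u v → u + half v + h) (weightedSum-nbr x j true) (coordSum-nbr x j true) ⟩
    weightedSum x + + toℕ j * + 1 + half (coordSum x + + 1) + h
      ≡⟨ cong (λ u → weightedSum x + + toℕ j * + 1 + u + h) (half-suc (coordSum x)) ⟩
    weightedSum x + + toℕ j * + 1 + (half (coordSum x) + bitℤ (par (coordSum x))) + h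
      ≡⟨ regroup (weightedSum x) (+ toℕ j) (half (coordSum x)) (bitℤ (par (coordSum x))) h ⟩
    origin x + + toℕ j + h ∎
    where
      open ≡-Reasoning
      h : ℤ
      h = high (φ (g (nbr x j true)))
      regroup : ∀ w t c b h → w + t * + 1 + (c + b) + h ≡ w + c + b + t + h
      regroup = solve-∀

  rawLabel-down : ∀ x j → rawLabel (nbr x j false) ≡ origin x - + suc (toℕ j) + high (φ (g (nbr x j false)))
  rawLabel-down x j = begin
    weightedSum (nbr x j false) + half (coordSum (nbr x j false)) + h
      ≡⟨ cong₂ (λ u v → u + half v + h) (weightedSum-nbr x j false) (coordSum-nbr x j false) ⟩
    weightedSum x + + toℕ j * - + 1 + half (coordSum x - + 1) + h
      ≡⟨ cong (λ u → weightedSum x + + toℕ j * - + 1 + u + h) (half-pred (coordSum x)) ⟩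
    weightedSum x + + toℕ j * - + 1 + (half (coordSum x) - bitℤ (not p)) + h
      ≡⟨ regroup (weightedSum x) (+ toℕ j) (half (coordSum x)) (bitℤ p) (bitℤ (not p)) h ⟩
    origin x - + toℕ j - (bitℤ p + bitℤ (not p)) + h
      ≡⟨ cong (λ u → origin x - + toℕ j - u + h) (bit-not p) ⟩
    origin x - + toℕ j - + 1 + h
      ≡⟨ cong (_+ h) (regroup′ (origin x) (+ toℕ j)) ⟩
    origin x - + suc (toℕ j) + h ∎
    where
      open ≡-Reasoning
      p : Bool
      p = par (coordSum x)
      h : ℤ
      h = high (φ (g (nbr x j false)))
      regroup : ∀ w t c b b′ h → w + t * - + 1 + (c - b′) + h ≡ w + c + b - t - (b + b′) + h
      regroup = solve-∀
      regroup′ : ∀ o t → o - t - + 1 ≡ o - (+ 1 + t)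
      regroup′ = solve-∀

  D≡N+N : + D ≡ + N + + N
  D≡N+N = trans (ℤP.pos-+ N (N ℕ.+ 0)) (cong (λ k → + N + + k) (ℕP.+-identityʳ N))

  high-flip : ∀ f → high f ≈ high (not f) + + N mod D
  high-flip true  = ≡⇒mod (sym (ℤP.+-identityˡ (+ N)))
  high-flip false = multiple -[1+ 0 ] (trans (cancel (+ N)) (cong (λ d → + N + + N + -[1+ 0 ] * d) (sym D≡N+N)))
    where cancel : ∀ n → + 0 ≡ n + n + -[1+ 0 ] * (n + n)
          cancel = solve-∀

  -- Digits (k , e) of Fin 2N in base N: the label offset N · e + k.
  encode : Fin N × Bool → Fin D
  encode (k , e) = F.combine (Inverse.from FP.2↔Bool e) k

  decode : Fin D → Fin N × Bool
  decode i = proj₂ (F.remQuot {2} N i) , Inverse.to FP.2↔Bool (proj₁ (F.remQuot {2} N i))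

  encode↔ : (Fin N × Bool) ↔ Fin D
  encode↔ = mk↔ₛ′ encode decode encode-decode decode-encode
    where
      encode-decode : ∀ i → encode (decode i) ≡ i
      encode-decode i = trans (cong (λ q → F.combine q (proj₂ (F.remQuot {2} N i)))
                                    (Inverse.strictlyInverseʳ FP.2↔Bool (proj₁ (F.remQuot {2} N i))))
                              (FP.combine-remQuot {2} N i)
      decode-encode : ∀ ke → decode (encode ke) ≡ ke
      decode-encode (k , e) =
        trans (cong (λ qk → proj₂ qk , Inverse.to FP.2↔Bool (proj₁ qk)) (FP.remQuot-combine (Inverse.from FP.2↔Bool e) k))
              (cong (k ,_) (Inverse.strictlyInverseˡ FP.2↔Bool e))

  offset : Fin N × Bool → ℤ
  offset (k , e) = high e + + toℕ k

  toℕ-encode : ∀ ke → + toℕ (encode ke) ≡ offset ke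
  toℕ-encode (k , false) = cong +_ (trans (FP.toℕ-combine {2} F.zero k) (cong (ℕ._+ toℕ k) (ℕP.*-zeroʳ N)))
  toℕ-encode (k , true)  = trans (cong +_ (trans (FP.toℕ-combine {2} (F.suc F.zero) k) (cong (ℕ._+ toℕ k) (ℕP.*-identityʳ N))))
                             (ℤP.pos-+ N (toℕ k))

  -- The neighbour x ± e_j gets the digits κ x (j , ±) relative to origin x:
  -- upward steps keep the axis, downward steps reverse it and complement the
  -- high digit.
  κ : Point N → Fin N × Bool → Fin N × Bool
  κ x (j , true)  = j , φ (g (nbr x j true))
  κ x (j , false) = F.opposite j , not (φ (g (nbr x j false)))

  -- Given digits (k , e) and f = φ (g (x + e_k)): the upward neighbour along k
  -- if e = f, otherwise the downward neighbour along opposite k.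
  pick : Fin N → Bool → Bool → Fin N × Bool
  pick k false false = k , true
  pick k true  true  = k , true
  pick k false true  = F.opposite k , false
  pick k true  false = F.opposite k , false

  κ⁻¹ : Point N → Fin N × Bool → Fin N × Bool
  κ⁻¹ x (k , e) = pick k e (φ (g (nbr x k true)))

  κ-opposite : ∀ x k → κ x (F.opposite k , false) ≡ (k , not (φ (g (nbr x k true))))
  κ-opposite x k = cong₂ _,_ (FP.opposite-involutive k) (cong (λ u → not (φ u)) (g-opposite x k))

  κ↔ : Point N → (Fin N × Bool) ↔ (Fin N × Bool)
  κ↔ x = mk↔ₛ′ (κ x) (κ⁻¹ x) κ-κ⁻¹ κ⁻¹-κ
    where
      κ-κ⁻¹ : ∀ ke → κ x (κ⁻¹ x ke) ≡ ke
      κ-κ⁻¹ (k , e) with φ (g (nbr x k true)) in f-eq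
      κ-κ⁻¹ (k , false) | false = cong (k ,_) f-eq
      κ-κ⁻¹ (k , true)  | true  = cong (k ,_) f-eq
      κ-κ⁻¹ (k , false) | true  = trans (κ-opposite x k) (cong (λ f → k , not f) f-eq)
      κ-κ⁻¹ (k , true)  | false = trans (κ-opposite x k) (cong (λ f → k , not f) f-eq)
      pick-same : ∀ k f → pick k f f ≡ (k , true)
      pick-same k false = refl
      pick-same k true  = refl
      pick-differ : ∀ k f → pick k (not f) f ≡ (F.opposite k , false)
      pick-differ k false = refl
      pick-differ k true  = refl
      κ⁻¹-κ : ∀ js → κ⁻¹ x (κ x js) ≡ js
      κ⁻¹-κ (j , true)  = pick-same j (φ (g (nbr x j true)))
      κ⁻¹-κ (j , false) = begin
        pick (F.opposite j) (not f) (φ (g (nbr x (F.opposite j) true)))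
          ≡⟨ cong (λ u → pick (F.opposite j) (not f) (φ u)) g-eq ⟩
        pick (F.opposite j) (not f) f
          ≡⟨ pick-differ (F.opposite j) f ⟩
        F.opposite (F.opposite j) , false
          ≡⟨ cong (_, false) (FP.opposite-involutive j) ⟩
        j , false ∎
        where
          open ≡-Reasoning
          f : Bool
          f = φ (g (nbr x j false))
          g-eq : g (nbr x (F.opposite j) true) ≡ g (nbr x j false)
          g-eq = trans (sym (g-opposite x (F.opposite j))) (cong (λ u → g (nbr x u false)) (FP.opposite-involutive j))

  opposite-sum : ∀ j → + N ≡ + toℕ (F.opposite j) + + suc (toℕ j)
  opposite-sum j = trans (cong +_ (sym (trans (cong (ℕ._+ suc (toℕ j)) (FP.opposite-prop j)) (ℕP.m∸n+n≡m (FP.toℕ<n j)))))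
                         (ℤP.pos-+ (toℕ (F.opposite j)) (suc (toℕ j)))

  rawLabel-nbr : ∀ x j s → rawLabel (nbr x j s) ≈ origin x + offset (κ x (j , s)) mod D
  rawLabel-nbr x j true = ≡⇒mod (trans (rawLabel-up x j) (swap (origin x) (+ toℕ j) (high (φ (g (nbr x j true))))))
    where swap : ∀ o t h → o + t + h ≡ o + (h + t)
          swap = solve-∀
  rawLabel-nbr x j false =
    mod-trans (≡⇒mod (rawLabel-down x j))
   (mod-trans (mod-+ˡ (origin x - + suc (toℕ j)) (high-flip f))
              (≡⇒mod (begin
      origin x - + suc (toℕ j) + (high (not f) + + N)
        ≡⟨ cong (λ n → origin x - + suc (toℕ j) + (high (not f) + n)) (opposite-sum j) ⟩
      origin x - + suc (toℕ j) + (high (not f) + (+ toℕ (F.opposite j) + + suc (toℕ j)))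
        ≡⟨ cancel (origin x) (+ suc (toℕ j)) (high (not f)) (+ toℕ (F.opposite j)) ⟩
      origin x + (high (not f) + + toℕ (F.opposite j)) ∎)))
    where
      open ≡-Reasoning
      f : Bool
      f = φ (g (nbr x j false))
      cancel : ∀ o S h O → o - S + (h + (O + S)) ≡ o + (h + O)
      cancel = solve-∀

  frame : Point N → (Fin N × Bool) ↔ Fin D
  frame x = shift D (origin x) ↔-∘ encode↔

  frame-spec : ∀ x {a} ke → a ≈ origin x + offset ke mod D → reduce D a ≡ Inverse.to (frame x) ke
  frame-spec x ke a≈ = reduce-cong D (mod-trans a≈ (≡⇒mod (cong (λ u → origin x + u) (sym (toℕ-encode ke)))))

  lab-nbr : ∀ x j s → lab (nbr x j s) ≡ Inverse.to (frame x ↔-∘ κ↔ x) (j , s)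
  lab-nbr x j s = frame-spec x (κ x (j , s)) (rawLabel-nbr x j s)

  lab-biased : IsBiased lab
  lab-biased = biased-by-bijection lab (λ x → frame x ↔-∘ κ↔ x , lab-nbr x)

  -- The digits of y's own label relative to origin y: (first, φ (g y)) if S y
  -- is even, (last, not φ (g y)) if S y is odd.
  selfDigits : Bool → Bool → Fin N × Bool
  selfDigits false f = F.zero , f
  selfDigits true  f = last , not f

  self : Point N → Fin N × Bool
  self y = selfDigits (par (coordSum y)) (φ (g y))

  rawLabel-self : ∀ y → rawLabel y ≈ origin y + offset (self y) mod D
  rawLabel-self y = shifted (weightedSum y + half (coordSum y)) (par (coordSum y)) (φ (g y))
    where
      shifted : ∀ b p f → b + high f ≈ b + bitℤ p + offset (selfDigits p f) mod D
      shifted b false f = ≡⇒mod (pad b (high f))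
        where pad : ∀ b h → b + h ≡ b + + 0 + (h + + 0)
              pad = solve-∀
      shifted b true f = mod-trans (mod-+ˡ b (high-flip f)) (≡⇒mod (begin
        b + (high (not f) + + N)                  ≡⟨ regroup b (high (not f)) (+ suc m) ⟩
        b + + 1 + (high (not f) + + suc m)         ≡⟨ cong (λ t → b + + 1 + (high (not f) + + t)) (FP.toℕ-fromℕ (suc m)) ⟨
        b + + 1 + (high (not f) + + toℕ last)      ∎))
        where
          open ≡-Reasoning
          regroup : ∀ b h M → b + (h + (+ 1 + M)) ≡ b + + 1 + (h + M)
          regroup = solve-∀

  mono⇒self : ∀ y j s → lab (nbr y j s) ≡ lab y → κ y (j , s) ≡ self y
  mono⇒self y j s same = begin
    κ y (j , s)                         ≡⟨ strictlyInverseʳ (κ y (j , s)) ⟨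
    from (to (κ y (j , s)))             ≡⟨ cong from (trans (sym (frame-spec y (κ y (j , s)) (rawLabel-nbr y j s)))
                                                     (trans same (frame-spec y (self y) (rawLabel-self y)))) ⟩
    from (to (self y))                  ≡⟨ strictlyInverseʳ (self y) ⟩
    self y                              ∎
    where
      open ≡-Reasoning
      open Inverse (frame y)

  self⇒mono : ∀ y j s → κ y (j , s) ≡ self y → lab (nbr y j s) ≡ lab y
  self⇒mono y j s κ≡self = trans (frame-spec y (κ y (j , s)) (rawLabel-nbr y j s))
    (trans (cong (Inverse.to (frame y)) κ≡self) (sym (frame-spec y (self y) (rawLabel-self y))))

  data MonoStep (y : Point N) : Fin N → Bool → Set where
    first⁺ : par (coordSum y) ≡ false → Steady φ (g y)           → MonoStep y F.zero true
    last⁻  : par (coordSum y) ≡ false → ¬ Steady φ (g y)         → MonoStep y last false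
    last⁺  : par (coordSum y) ≡ true  → ¬ Steady φ (g y - + 1)   → MonoStep y last true
    first⁻ : par (coordSum y) ≡ true  → Steady φ (g y - + 1)     → MonoStep y F.zero false

  private
    down-up : ∀ a → a - + 1 + + 1 ≡ a
    down-up = solve-∀

  classify-by : ∀ y j s p → par (coordSum y) ≡ p → κ y (j , s) ≡ selfDigits p (φ (g y)) → MonoStep y j s
  classify-by y j true false parity e = subst (λ j → MonoStep y j true) (sym j≡first)
    (first⁺ parity (trans (cong φ (sym (g-first y true))) (trans (cong (λ k → φ (g (nbr y k true))) (sym j≡first)) f-eq)))
    where
      j≡first : j ≡ F.zero
      j≡first = proj₁ (,-injective e)
      f-eq : φ (g (nbr y j true)) ≡ φ (g y)
      f-eq = proj₂ (,-injective e)
  classify-by y j true true parity e = subst (λ j → MonoStep y j true) (sym j≡last)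
    (last⁺ parity λ st → BP.not-¬ refl (begin
      φ (g y)                   ≡⟨ cong φ (down-up (g y)) ⟨
      φ (g y - + 1 + + 1)       ≡⟨ st ⟩
      φ (g y - + 1)             ≡⟨ cong φ (g-last y true) ⟨
      φ (g (nbr y last true))   ≡⟨ cong (λ k → φ (g (nbr y k true))) j≡last ⟨
      φ (g (nbr y j true))      ≡⟨ proj₂ (,-injective e) ⟩
      not (φ (g y))             ∎))
    where
      open ≡-Reasoning
      j≡last : j ≡ last
      j≡last = proj₁ (,-injective e)
  classify-by y j false false parity e = subst (λ j → MonoStep y j false) (sym j≡last)
    (last⁻ parity λ st → BP.not-¬ refl (begin
      φ (g y)                           ≡⟨ proj₂ (,-injective e) ⟨
      not (φ (g (nbr y j false)))       ≡⟨ cong (λ k → not (φ (g (nbr y k false)))) j≡last ⟩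
      not (φ (g (nbr y last false)))    ≡⟨ cong (λ w → not (φ w)) (g-last⁻ y) ⟩
      not (φ (g y + + 1))               ≡⟨ cong not st ⟩
      not (φ (g y))                     ∎))
    where
      open ≡-Reasoning
      j≡last : j ≡ last
      j≡last = opposite-eq (proj₁ (,-injective e))
  classify-by y j false true parity e = subst (λ j → MonoStep y j false) (sym j≡first)
    (first⁻ parity (begin
      φ (g y - + 1 + + 1)               ≡⟨ cong φ (down-up (g y)) ⟩
      φ (g y)                           ≡⟨ BP.not-injective (proj₂ (,-injective e)) ⟨
      φ (g (nbr y j false))             ≡⟨ cong (λ k → φ (g (nbr y k false))) j≡first ⟩
      φ (g (nbr y F.zero false))        ≡⟨ cong φ (g-first y false) ⟩
      φ (g y - + 1)                     ∎))
    where
      open ≡-Reasoning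
      j≡first : j ≡ F.zero
      j≡first = trans (opposite-eq (proj₁ (,-injective e))) (FP.opposite-involutive {n = N} F.zero)

  classify : ∀ y j s → lab (nbr y j s) ≡ lab y → MonoStep y j s
  classify y j s same = classify-by y j s (par (coordSum y)) refl (mono⇒self y j s same)

  first⁺-mono : ∀ y → par (coordSum y) ≡ false → Steady φ (g y) → lab (nbr y F.zero true) ≡ lab y
  first⁺-mono y parity st = self⇒mono y F.zero true
    (trans (cong (F.zero ,_) (trans (cong φ (g-first y true)) st)) (cong (λ p → selfDigits p (φ (g y))) (sym parity)))

  first⁻-mono : ∀ y → par (coordSum y) ≡ true → Steady φ (g y - + 1) → lab (nbr y F.zero false) ≡ lab y
  first⁻-mono y parity st = self⇒mono y F.zero false
    (trans (cong (λ f → last , not f) (trans (cong φ (g-first y false)) (trans (sym st) (cong φ (down-up (g y))))))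
           (cong (λ p → selfDigits p (φ (g y))) (sym parity)))

  first⁺-steady : ∀ {y} → MonoStep y F.zero true → Steady φ (g y)
  first⁺-steady (first⁺ _ st) = st

  first⁻-steady : ∀ {y} → MonoStep y F.zero false → Steady φ (g y - + 1)
  first⁻-steady (first⁻ _ st) = st

  last⁻-unsteady : ∀ {y} → MonoStep y last false → ¬ Steady φ (g y)
  last⁻-unsteady (last⁻ _ ¬st) = ¬st

  last⁺-unsteady : ∀ {y} → MonoStep y last true → ¬ Steady φ (g y - + 1)
  last⁺-unsteady (last⁺ _ ¬st) = ¬st

  first⁺-bichromatic : ∀ y → ¬ Steady φ (g y) → lab (nbr y F.zero true) ≢ lab y
  first⁺-bichromatic y ¬st same = ¬st (first⁺-steady (classify y F.zero true same))

  g-ascending : ∀ {z j s} → StraightLine z j s → (∀ y → g (nbr y j s) ≡ g y + + 1) →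
                ∀ t → g (z t) ≡ g (z 0) + + t
  g-ascending line up zero    = sym (ℤP.+-identityʳ _)
  g-ascending {z} {j} {s} line up (suc t) = begin
    g (z (suc t))         ≡⟨ cong g (moves line t) ⟩
    g (nbr (z t) j s)     ≡⟨ up (z t) ⟩
    g (z t) + + 1         ≡⟨ cong (_+ + 1) (g-ascending {z} {j} {s} line up t) ⟩
    g (z 0) + + t + + 1   ≡⟨ regroup (g (z 0)) (+ t) ⟩
    g (z 0) + + suc t     ∎
    where
      open ≡-Reasoning
      regroup : ∀ a t → a + t + + 1 ≡ a + (+ 1 + t)
      regroup = solve-∀

  g-descending : ∀ {z j s} → StraightLine z j s → (∀ y → g (nbr y j s) ≡ g y - + 1) →
                 ∀ t → g (z t) ≡ g (z 0) - + t
  g-descending line down zero    = sym (ℤP.+-identityʳ _)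
  g-descending {z} {j} {s} line down (suc t) = begin
    g (z (suc t))         ≡⟨ cong g (moves line t) ⟩
    g (nbr (z t) j s)     ≡⟨ down (z t) ⟩
    g (z t) - + 1         ≡⟨ cong (_- + 1) (g-descending {z} {j} {s} line down t) ⟩
    g (z 0) - + t - + 1   ≡⟨ regroup (g (z 0)) (+ t) ⟩
    g (z 0) - + suc t     ∎
    where
      open ≡-Reasoning
      regroup : ∀ a t → a - t - + 1 ≡ a - (+ 1 + t)
      regroup = solve-∀

  -- A marker of length M ≥ 2 in lab is a straight ray whose first
  -- monochromatic edge has one of the four kinds above; along the first axis
  -- the marker reads off a run of φ of length M, along the last axis two
  -- kinks of φ at distance 2.
  module MarkerAnalysis {M} (mk : Marker lab M) (2≤M : 2 ℕ.≤ M) where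
    open Marker mk

    0<M : 0 ℕ.< M
    0<M = ℕP.<-≤-trans (ℕ.s≤s ℕ.z≤n) 2≤M

    module _ {j s} (line : StraightLine ray j s) where
      mono-at : ∀ i → i ℕ.< M → MonoStep (ray (twice+2 i)) j s
      mono-at i i<M = classify _ j s (sym (trans (mono i i<M) (cong lab (moves line _))))

      bichromatic-at : ∀ t → lab (ray t) ≢ lab (ray (suc t)) → lab (nbr (ray t) j s) ≢ lab (ray t)
      bichromatic-at t ne same = ne (sym (trans (cong lab (moves line t)) same))

      parity-at : ∀ {p} → par (coordSum (ray 2)) ≡ p → ∀ i → par (coordSum (ray (twice+2 i))) ≡ p
      parity-at parity i = trans (par-along line i) (trans (sym (par-along line 0)) parity)

    ascending-run : StraightLine ray F.zero true → par (coordSum (ray 2)) ≡ false → Run₂ φ M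
    ascending-run line parity = g (ray 0) , ¬st₀ , steady , ¬st₁
      where
        g-ray : ∀ t → g (ray t) ≡ g (ray 0) + + t
        g-ray = g-ascending line (λ y → g-first y true)
        ¬st₀ : ¬ Steady φ (g (ray 0))
        ¬st₀ st = bichromatic-at line 0 start (first⁺-mono (ray 0) (trans (sym (par-along line 0)) parity) st)
        steady : ∀ i → i ℕ.< M → Steady φ (g (ray 0) + + twice+2 i)
        steady i i<M = subst (Steady φ) (g-ray (twice+2 i)) (first⁺-steady (mono-at line i i<M))
        ¬st₁ : ¬ Steady φ (g (ray 0) + + twice+2 M)
        ¬st₁ st = bichromatic-at line (twice+2 M) stop
          (first⁺-mono (ray (twice+2 M)) (parity-at line parity M) (subst (Steady φ) (sym (g-ray (twice+2 M))) st))

    descending-run : StraightLine ray F.zero false → par (coordSum (ray 2)) ≡ true → DescendingRun₂ φ M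
    descending-run line parity = g (ray 0) - + 1 , ¬st₀ , steady , ¬st₁
      where
        g-ray : ∀ t → g (ray t) ≡ g (ray 0) - + t
        g-ray = g-descending line (λ y → g-first y false)
        below : ∀ t → g (ray t) - + 1 ≡ g (ray 0) - + 1 - + t
        below t = trans (cong (_- + 1) (g-ray t)) (swap (g (ray 0)) (+ t))
          where swap : ∀ a t → a - t - + 1 ≡ a - + 1 - t
                swap = solve-∀
        ¬st₀ : ¬ Steady φ (g (ray 0) - + 1)
        ¬st₀ st = bichromatic-at line 0 start (first⁻-mono (ray 0) (trans (sym (par-along line 0)) parity) st)
        steady : ∀ i → i ℕ.< M → Steady φ (g (ray 0) - + 1 - + twice+2 i)
        steady i i<M = subst (Steady φ) (below (twice+2 i)) (first⁻-steady (mono-at line i i<M))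
        ¬st₁ : ¬ Steady φ (g (ray 0) - + 1 - + twice+2 M)
        ¬st₁ st = bichromatic-at line (twice+2 M) stop
          (first⁻-mono (ray (twice+2 M)) (parity-at line parity M) (subst (Steady φ) (sym (below (twice+2 M))) st))

    -- Two steps apart along the ray, g differs by 2.
    kinks-last⁻ : StraightLine ray last false → Kinks₂ φ
    kinks-last⁻ line = g (ray 2) , last⁻-unsteady (mono-at line 0 0<M) , λ st →
      last⁻-unsteady (mono-at line 1 2≤M) (subst (Steady φ) ray4 st)
      where
        g-ray : ∀ t → g (ray t) ≡ g (ray 0) + + t
        g-ray = g-ascending line g-last⁻
        ray4 : g (ray 2) + + 2 ≡ g (ray 4)
        ray4 = trans (cong (_+ + 2) (g-ray 2)) (trans (ℤP.+-assoc (g (ray 0)) (+ 2) (+ 2)) (sym (g-ray 4)))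

    kinks-last⁺ : StraightLine ray last true → Kinks₂ φ
    kinks-last⁺ line = g (ray 4) - + 1 , last⁺-unsteady (mono-at line 1 2≤M) , λ st →
      last⁺-unsteady (mono-at line 0 0<M) (subst (Steady φ) ray2 st)
      where
        g-ray : ∀ t → g (ray t) ≡ g (ray 0) - + t
        g-ray = g-descending line (λ y → g-last y true)
        ray2 : g (ray 4) - + 1 + + 2 ≡ g (ray 2) - + 1
        ray2 = trans (cong (λ u → u - + 1 + + 2) (g-ray 4))
                     (trans (regroup (g (ray 0))) (cong (_- + 1) (sym (g-ray 2))))
          where regroup : ∀ a → a - + 4 - + 1 + + 2 ≡ a - + 2 - + 1
                regroup = solve-∀

    by-first-step : ∀ {j s} → StraightLine ray j s → MonoStep (ray 2) j s → Run₂ φ M ⊎ Kinks₂ φ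
    by-first-step line (first⁺ parity _) = inj₁ (ascending-run line parity)
    by-first-step line (last⁻ _ _)       = inj₂ (kinks-last⁻ line)
    by-first-step line (last⁺ _ _)       = inj₂ (kinks-last⁺ line)
    by-first-step line (first⁻ parity _) = inj₁ (descending⇒run₂ φ M (descending-run line parity))

  marker⇒run-or-kinks : ∀ M → 2 ℕ.≤ M → Marker lab M → Run₂ φ M ⊎ Kinks₂ φ
  marker⇒run-or-kinks M 2≤M mk with straight-line ray step only
    where open Marker mk
  ... | j , s , line = by-first-step line (mono-at line 0 0<M)
    where open MarkerAnalysis mk 2≤M

-- A sequence whose runs have exactly the lengths 2k + 2 + a k

module Blocks (a : ℕ → Bool) where

  len : ℕ → ℕ
  len k = suc (suc (k ℕ.+ k ℕ.+ bitℕ (a k)))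

  -- steady u says whether the sequence stays constant from u to u + 1.  It is
  -- false at the change points 0 = pos 0 < pos 1 < …, and the change points
  -- pos k and pos (suc k) are separated by len k steady points.  It is
  -- computed by a machine whose phase (k , r) means: in run k, r steady points
  -- still to come (r = 0 at the change point before run k).
  advance : ℕ × ℕ → ℕ × ℕ
  advance (k , zero)          = k , len k
  advance (k , suc zero)      = suc k , zero
  advance (k , suc (suc r))   = k , suc r

  phase : ℕ → ℕ × ℕ
  phase zero    = 0 , 0
  phase (suc u) = advance (phase u)

  inside : ℕ × ℕ → Bool
  inside (_ , zero)  = false
  inside (_ , suc _) = true

  steady : ℕ → Bool
  steady u = inside (phase u)

  block-run : ∀ r k u → phase u ≡ (k , suc r) →
              (∀ i → i ℕ.≤ r → steady (u ℕ.+ i) ≡ true) × phase (u ℕ.+ suc r) ≡ (suc k , 0)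
  block-run zero k u at = (λ { .zero ℕ.z≤n → cong inside (trans (cong phase (ℕP.+-identityʳ u)) at) })
                        , trans (cong phase (ℕP.+-comm u 1)) (cong advance at)
  block-run (suc r) k u at with block-run r k (suc u) (cong advance at)
  ... | rest , end = steady-from , trans (cong phase (ℕP.+-suc u (suc r))) end
    where
      steady-from : ∀ i → i ℕ.≤ suc r → steady (u ℕ.+ i) ≡ true
      steady-from zero    _             = cong inside (trans (cong phase (ℕP.+-identityʳ u)) at)
      steady-from (suc i) (ℕ.s≤s i≤r)   = trans (cong steady (ℕP.+-suc u i)) (rest i i≤r)

  at-change : ∀ w → steady w ≡ false → phase w ≡ (proj₁ (phase w) , 0)
  at-change w ch with phase w
  ... | k , zero  = refl
  ... | k , suc r = ⊥-elim (BP.not-¬ refl ch)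

  no-adjacent-changes : ∀ w → steady w ≡ false → steady (suc w) ≡ true
  no-adjacent-changes w ch = cong (λ ph → inside (advance ph)) (at-change w ch)

  run-after : ∀ w k → phase w ≡ (k , 0) →
              (∀ i → i ℕ.< len k → steady (suc w ℕ.+ i) ≡ true) × phase (suc w ℕ.+ len k) ≡ (suc k , 0)
  run-after w k at with block-run (suc (k ℕ.+ k ℕ.+ bitℕ (a k))) k (suc w) (cong advance at)
  ... | inner , end = (λ i i<len → inner i (ℕP.≤-pred i<len)) , end

  runs-are-blocks : ∀ w M → steady w ≡ false → (∀ i → i ℕ.< M → steady (w ℕ.+ suc i) ≡ true) →
                    steady (w ℕ.+ suc M) ≡ false → Σ ℕ λ k → M ≡ len k
  runs-are-blocks w M ch run ch′ = k , compare (ℕP.<-cmp M (len k))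
    where
      k : ℕ
      k = proj₁ (phase w)
      block : (∀ i → i ℕ.< len k → steady (suc w ℕ.+ i) ≡ true) × phase (suc w ℕ.+ len k) ≡ (suc k , 0)
      block = run-after w k (at-change w ch)
      compare : Tri (M ℕ.< len k) (M ≡ len k) (len k ℕ.< M) → M ≡ len k
      compare (tri< M<len _ _) = ⊥-elim (BP.not-¬ refl
        (trans (sym (proj₁ block M M<len)) (trans (cong steady (sym (ℕP.+-suc w M))) ch′)))
      compare (tri≈ _ M≡len _) = M≡len
      compare (tri> _ _ len<M) = ⊥-elim (BP.not-¬ refl
        (trans (sym (run (len k) len<M)) (trans (cong steady (ℕP.+-suc w (len k))) (cong inside (proj₂ block)))))

  pos : ℕ → ℕ
  pos zero    = 0
  pos (suc k) = pos k ℕ.+ suc (len k)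

  phase-pos : ∀ k → phase (pos k) ≡ (k , 0)
  phase-pos zero    = refl
  phase-pos (suc k) = trans (cong phase (ℕP.+-suc (pos k) (len k))) (proj₂ (run-after (pos k) k (phase-pos k)))

  change-at-pos : ∀ k → steady (pos k) ≡ false
  change-at-pos k = cong inside (phase-pos k)

  steady-in-run : ∀ k i → i ℕ.< len k → steady (pos k ℕ.+ suc i) ≡ true
  steady-in-run k i i<len = trans (cong steady (ℕP.+-suc (pos k) i)) (proj₁ (run-after (pos k) k (phase-pos k)) i i<len)

  seq : ℕ → Bool
  seq zero    = false
  seq (suc u) = if steady u then seq u else not (seq u)

  β : ℤ → Bool
  β (+ u)    = seq u
  β -[1+ _ ] = false

  steadyℤ : ℤ → Bool
  steadyℤ (+ u)    = steady u
  steadyℤ -[1+ _ ] = true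

  β-step : ∀ v → β (v + + 1) ≡ (if steadyℤ v then β v else not (β v))
  β-step (+ u)          = cong seq (ℕP.+-comm u 1)
  β-step -[1+ zero ]    = refl
  β-step -[1+ suc k ]   = refl

  steady⇒ : ∀ v → Steady β v → steadyℤ v ≡ true
  steady⇒ v st with steadyℤ v | β-step v
  ... | true  | _    = refl
  ... | false | step = ⊥-elim (BP.not-¬ refl (sym (trans (sym step) st)))

  steady⇐ : ∀ v → steadyℤ v ≡ true → Steady β v
  steady⇐ v e = trans (β-step v) (cong (λ c → if c then β v else not (β v)) e)

  unsteady⇒ : ∀ v → ¬ Steady β v → steadyℤ v ≡ false
  unsteady⇒ v ¬st with steadyℤ v in e
  ... | false = refl
  ... | true  = ⊥-elim (¬st (steady⇐ v e))

  unsteady⇐ : ∀ v → steadyℤ v ≡ false → ¬ Steady β v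
  unsteady⇐ v e st = BP.not-¬ refl (trans (sym (steady⇒ v st)) e)

  run-lengths : ∀ M → Run₁ β M → Σ ℕ λ k → M ≡ len k
  run-lengths M (+ w , ¬st₀ , run , ¬st₁) =
    runs-are-blocks w M (unsteady⇒ (+ w) ¬st₀) (λ i i<M → steady⇒ (+ w + + suc i) (run i i<M))
                        (unsteady⇒ (+ w + + suc M) ¬st₁)
  run-lengths M (-[1+ w ] , ¬st₀ , _) = ⊥-elim (¬st₀ (steady⇐ -[1+ w ] refl))

  no-kinks : ¬ Kinks₁ β
  no-kinks (+ w , ¬st₀ , ¬st₁) =
    ¬st₁ (steady⇐ (+ w + + 1) (trans (cong steady (ℕP.+-comm w 1)) (no-adjacent-changes w (unsteady⇒ (+ w) ¬st₀))))
  no-kinks (-[1+ w ] , ¬st₀ , _) = ¬st₀ (steady⇐ -[1+ w ] refl)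

module Family (m : ℕ) (a : ℕ → Bool) where
  open Blocks a public
  open Construction m β public

  partition : BiasedPartition N
  partition = record { label = lab ; biased = lab-biased }

  -- The ray from (2 · pos k, 0, …, 0) along the first axis carries a marker of
  -- length len k: g runs through 2 pos k, 2 pos k + 1, …, so φ = spread β
  -- shows the k-th run of β.
  module MarkerOfBlock (k : ℕ) where
    p : ℕ
    p = pos k

    start-point : Point N
    start-point = + (p ℕ.+ p) ∷ replicate (suc m) (+ 0)

    ray : ℕ → Point N
    ray zero    = start-point
    ray (suc t) = nbr (ray t) F.zero true

    line : StraightLine ray F.zero true
    line = straight λ _ → refl

    g-start : g start-point ≡ + p + + p
    g-start = trans (cong (λ v → + (p ℕ.+ p) - v) (VP.lookup-replicate (F.fromℕ m) (+ 0)))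
                    (trans (ℤP.+-identityʳ _) (ℤP.pos-+ p p))

    par-start : par (coordSum start-point) ≡ false
    par-start = trans (cong par (trans (cong (λ v → + (p ℕ.+ p) + v) (coordSum-zeros (suc m)))
                                       (ℤP.+-identityʳ (+ (p ℕ.+ p)))))
                      (parℕ-double p)

    g-at : ∀ i → g (ray (twice+2 i)) ≡ (+ p + + suc i) + (+ p + + suc i)
    g-at i = trans (g-ascending line (λ y → g-first y true) (twice+2 i))
                   (trans (cong (_+ + twice+2 i) g-start) (double-shift (+ p) i))

    unsteady-φ : ∀ {w} u → w ≡ u + u → ¬ Steady β u → ¬ Steady φ w
    unsteady-φ u refl ¬st st = ¬st (spread-steady-even⇒ β u st)

    steady-at : ∀ i → i ℕ.< len k → Steady φ (g (ray (twice+2 i)))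
    steady-at i i<len = subst (Steady φ) (sym (g-at i))
      (spread-steady-even⇐ β (+ p + + suc i) (steady⇐ (+ p + + suc i) (steady-in-run k i i<len)))

    unsteady-start : ¬ Steady φ (g start-point)
    unsteady-start = unsteady-φ (+ p) g-start (unsteady⇐ (+ p) (change-at-pos k))

    unsteady-stop : ¬ Steady φ (g (ray (twice+2 (len k))))
    unsteady-stop = unsteady-φ (+ p + + suc (len k)) (g-at (len k)) (unsteady⇐ (+ p + + suc (len k)) (change-at-pos (suc k)))

    marker : Marker lab (len k)
    marker = record
      { ray   = ray
      ; step  = λ i → F.zero , true , refl
      ; only  = λ i → segment-only-middle (ray i) F.zero true
      ; mono  = λ i i<len → sym (first⁺-mono (ray (twice+2 i)) (trans (par-along line i) par-start) (steady-at i i<len))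
      ; start = λ same → first⁺-bichromatic start-point unsteady-start (sym same)
      ; stop  = λ same → first⁺-bichromatic (ray (twice+2 (len k))) unsteady-stop (sym same)
      }

-- Countability: a labelling of ℤⁿ is determined by a sequence of bits

-- Cantor's enumeration of ℕ × ℕ, diagonal by diagonal.
next-pair : ℕ × ℕ → ℕ × ℕ
next-pair (a , zero)  = 0 , suc a
next-pair (a , suc b) = suc a , b

unpair : ℕ → ℕ × ℕ
unpair zero    = 0 , 0
unpair (suc k) = next-pair (unpair k)

unpair-onto : ∀ a b → Σ ℕ λ k → unpair k ≡ (a , b)
unpair-onto a b = on-diagonal (a ℕ.+ b) a b refl
  where
    on-diagonal : ∀ d a b → a ℕ.+ b ≡ d → Σ ℕ λ k → unpair k ≡ (a , b)
    on-diagonal d (suc a) b sum with on-diagonal d a (suc b) (trans (ℕP.+-suc a b) sum)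
    ... | k , at = suc k , cong next-pair at
    on-diagonal zero    zero zero    _   = 0 , refl
    on-diagonal (suc d) zero (suc b) sum with on-diagonal d b zero (trans (ℕP.+-identityʳ b) (ℕP.suc-injective sum))
    ... | k , at = suc k , cong next-pair at

enumℤ : ℕ → ℤ
enumℤ k = + proj₁ (unpair k) - + proj₂ (unpair k)

enumℤ-onto : ∀ x → Σ ℕ λ k → enumℤ k ≡ x
enumℤ-onto (+ t) with unpair-onto t 0
... | k , at = k , trans (cong (λ q → + proj₁ q - + proj₂ q) at) (ℤP.+-identityʳ (+ t))
enumℤ-onto -[1+ t ] with unpair-onto 0 (suc t)
... | k , at = k , cong (λ q → + proj₁ q - + proj₂ q) at

enumPoint : ∀ n → ℕ → Point n
enumPoint zero    k = []
enumPoint (suc n) k = enumℤ (proj₁ (unpair k)) ∷ enumPoint n (proj₂ (unpair k))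

enumPoint-onto : ∀ n (x : Point n) → Σ ℕ λ k → enumPoint n k ≡ x
enumPoint-onto zero    []      = 0 , refl
enumPoint-onto (suc n) (c ∷ x) with enumℤ-onto c | enumPoint-onto n x
... | kc , at-c | kx , at-x with unpair-onto kc kx
... | k , at = k , cong₂ _∷_ (trans (cong (λ q → enumℤ (proj₁ q)) at) at-c)
                             (trans (cong (λ q → enumPoint n (proj₂ q)) at) at-x)

-- Bit number k answers "is the label of point number i equal to j?" where (i , j) = unpair k.
label-bits : ∀ {n} → BiasedPartition n → ℕ → Bool
label-bits {n} P k = ⌊ toℕ (label P (enumPoint n (proj₁ (unpair k)))) ℕ.≟ proj₂ (unpair k) ⌋

label-bits-injective : ∀ {n} (P Q : BiasedPartition n) →
                       (∀ k → label-bits P k ≡ label-bits Q k) → ∀ x → label P x ≡ label Q x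
label-bits-injective {n} P Q same x with enumPoint-onto n x
... | i , at-x with unpair-onto i (toℕ (label P x))
... | k , at = FP.toℕ-injective (sym (toWitness (subst T (trans (sym (bit-at P)) (trans (same k) (bit-at Q)))
                                                         (fromWitness {a? = toℕ (label P x) ℕ.≟ toℕ (label P x)} refl))))
  where
    bit-at : ∀ R → label-bits R k ≡ ⌊ toℕ (label R x) ℕ.≟ toℕ (label P x) ⌋
    bit-at R = trans (cong (λ q → ⌊ toℕ (label R (enumPoint n (proj₁ q))) ℕ.≟ proj₂ q ⌋) at)
                     (cong (λ v → ⌊ toℕ (label R v) ℕ.≟ toℕ (label P x) ⌋) at-x)

-- The marker of length len_a k of partition a reappears in any isomorphic
-- partition b; there it comes from a run of β_b (kinks do not occur), whose
-- length is len_b k′ = 2k′ + 2 + b k′.  Comparing, k′ = k and a k = b k.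
family-injective : ∀ m a b → Isomorphic (Family.partition m a) (Family.partition m b) → ∀ k → a k ≡ b k
family-injective m a b iso k = from-analysis (B.marker⇒run-or-kinks (A.len k) (ℕ.s≤s (ℕ.s≤s ℕ.z≤n)) marker-in-b)
  where
    module A = Family m a
    module B = Family m b
    marker-in-b : Marker B.lab (A.len k)
    marker-in-b = transport-marker A.partition B.partition (A.len k) iso (A.MarkerOfBlock.marker k)
    from-length : Σ ℕ (λ k′ → A.len k ≡ B.len k′) → a k ≡ b k
    from-length (k′ , same-length) with 2k+b-injective (ℕP.suc-injective (ℕP.suc-injective same-length))
    ... | k≡k′ , ak≡bk′ = trans ak≡bk′ (cong b (sym k≡k′))
    from-analysis : Run₂ (spread B.β) (A.len k) ⊎ Kinks₂ (spread B.β) → a k ≡ b k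
    from-analysis (inj₁ run)   = from-length (B.run-lengths (A.len k) (run₂⇒run₁ B.β (A.len k) run))
    from-analysis (inj₂ kinks) = ⊥-elim (B.no-kinks (kinks₂⇒kinks₁ B.β kinks))

theorem4p2 : (n : ℕ) → 2 ≤ n →
    Σ ((ℕ → Bool) → BiasedPartition n)
      (λ F → ∀ a b → Isomorphic (F a) (F b) → ∀ k → a k ≡ b k)
    ×
    Σ (BiasedPartition n → (ℕ → Bool))
      (λ G → ∀ P Q → (∀ k → G P k ≡ G Q k) → ∀ x → label P x ≡ label Q x)
theorem4p2 (suc zero) (ℕ.s≤s ())
theorem4p2 (suc (suc m)) _ = (Family.partition m , family-injective m) , (label-bits , label-bits-injective)
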